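{- Let $G$ be a graph obtained from a clique on at least $2$ vertices by choosing at least two of the clique vertices and attaching to each chosen vertex at least three pendant edges (each leading to a new vertex of degree 1). Then $G$ is strongly non-stackable.
   Context: Cup stacking on a finite connected graph: initially one cup on every vertex; a move takes all $r\ge1$ cups from a vertex $x$ onto a vertex $y\neq x$ that already carries at least one cup and satisfies $d(x,y)=r$ (shortest-path distance). A graph is $t$-stackable if some sequence of moves ends with all cups on $t$; it is strongly non-stackable if it is not $t$-stackable for any vertex $t$. -}

module Defs where

open import Level using (0ℓ)
open import Data.Nat using (ℕ; zero; suc; _+_; _≤_; _<_)
open import Data.Fin using (Fin)
open import Data.Product using (∃; _×_)
open import Relation.Nullary using (¬_)
open import Relation.Binary.PropositionalEquality using (_≡_; _≢_)
open import Relation.Binary.Construct.Closure.ReflexiveTransitive using (Star)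

module CupStacking {V : Set} (Adj : V → V → Set) where

  data Walk : V → V → ℕ → Set where
    here : ∀ {x} → Walk x x 0
    step : ∀ {x y z k} → Adj x y → Walk y z k → Walk x z (suc k)

  Dist : V → V → ℕ → Set
  Dist x y r = Walk x y r × (∀ k → k < r → ¬ Walk x y k)

  Config : Set
  Config = V → ℕ

  data Move (c c' : Config) : Set where
    move : (x y : V) → x ≢ y → 1 ≤ c x → 1 ≤ c y → Dist x y (c x)
         → c' x ≡ 0
         → c' y ≡ c y + c x
         → (∀ v → v ≢ x → v ≢ y → c' v ≡ c v)
         → Move c c'

  initial : Config
  initial _ = 1

  Stackable : V → Set
  Stackable t = ∃ λ c → Star Move initial c × (∀ v → v ≢ t → c v ≡ 0)

  StronglyNonStackable : Set
  StronglyNonStackable = ∀ t → ¬ Stackable t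

data CPVertex (k : ℕ) (p : Fin k → ℕ) : Set where
  core : Fin k → CPVertex k p
  leaf : (i : Fin k) → Fin (p i) → CPVertex k p

data CPAdj (k : ℕ) (p : Fin k → ℕ) : CPVertex k p → CPVertex k p → Set where
  core-core : ∀ {i j} → i ≢ j → CPAdj k p (core i) (core j)
  core-leaf : ∀ i (l : Fin (p i)) → CPAdj k p (core i) (leaf i l)
  leaf-core : ∀ i (l : Fin (p i)) → CPAdj k p (leaf i l) (core i)

module Submission where

open import Defs
open import Data.Nat using (ℕ; _≤_)
open import Data.Fin using (Fin)
open import Data.Product using (∃₂; _×_)
open import Data.Sum using (_⊎_)
open import Relation.Binary.PropositionalEquality using (_≡_; _≢_)

open import Data.Empty using (⊥; ⊥-elim)
open import Data.Fin as Fin using (zero; suc; punchIn; fromℕ<)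
open import Data.Fin.Properties using (¬Fin0; 0≢1+n; punchIn-injective; punchInᵢ≢i)
open import Data.Nat using (suc; _+_; _<_; z≤n; s≤s)
open import Data.Nat.Properties
  using (≤-trans; ≤-antisym; ≤-reflexive; ≤-pred; <⇒≤; <⇒≱; ≮⇒≥; n≤1+n; m<n+m; m<m+n; 1+n≢0)
open import Data.Product using (∃; _,_)
open import Data.Sum using (inj₁; inj₂)
open import Function using (_∘_; id)
open import Relation.Binary.Definitions using (DecidableEquality)
open import Relation.Binary.Construct.Closure.ReflexiveTransitive using (fold)
open import Relation.Binary.PropositionalEquality using (refl; sym; trans; cong; subst)
open import Relation.Nullary using (¬_; yes; no)
open import Relation.Nullary.Decidable using (map′)

-- Fix the target t and a hub h: a clique vertex with at least three leaves such that
-- core h ≠ t and t is not a leaf of another clique vertex.  A leaf of h holding a single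
-- cup can only move onto core h, and can only receive the single cup of core h; either
-- way core h ends up with 0 or at least 2 cups, after which a second lone leaf of h can
-- never move again.  Together with the eccentricity bounds this gives conditions that
-- hold at every configuration from which the cups can still be stacked on t; they are
-- preserved backwards along moves and fail initially, where h has two lone leaves ≠ t.

module CupStackingFacts {V : Set} (Adj : V → V → Set) where
  open CupStacking Adj

  Within : ℕ → V → V → Set
  Within n x y = ∃ λ w → w ≤ n × Walk x y w

  within-refl : ∀ {n x} → Within n x x
  within-refl = 0 , z≤n , here

  within-step : ∀ {n x y z} → Adj x y → Within n y z → Within (suc n) x z
  within-step adj (w , w≤n , walk) = suc w , s≤s w≤n , step adj walk

  within-weaken : ∀ {m n x y} → m ≤ n → Within m x y → Within n x y
  within-weaken m≤n (w , w≤m , walk) = w , ≤-trans w≤m m≤n , walk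

  dist≤within : ∀ {n r x y} → Dist x y r → Within n x y → r ≤ n
  dist≤within (_ , shortest) (w , w≤n , walk) = ≤-trans (≮⇒≥ λ w<r → shortest w w<r walk) w≤n

  ¬stackable-by-backward-invariant : ∀ t (P : Config → Set)
    → (∀ f → (∀ v → v ≢ t → f v ≡ 0) → P f)
    → (∀ {c c'} → Move c c' → P c' → P c)
    → ¬ P initial → ¬ Stackable t
  ¬stackable-by-backward-invariant t P stacked⇒P reflect ¬P-initial (f , moves , stacked) =
    ¬P-initial (fold (λ c c' → P c' → P c) (λ m r → reflect m ∘ r) id moves (stacked⇒P f stacked))

two-distinct-avoiding : ∀ {n} → 3 ≤ n → (a : Fin n) → ∃₂ λ i j → i ≢ j × i ≢ a × j ≢ a
two-distinct-avoiding (s≤s (s≤s (s≤s _))) a =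
  punchIn a zero , punchIn a (suc zero) ,
  0≢1+n ∘ punchIn-injective a _ _ , punchInᵢ≢i a _ , punchInᵢ≢i a _

module CliquePendant (k : ℕ) (p : Fin k → ℕ) where
  open CupStacking (CPAdj k p)
  open CupStackingFacts (CPAdj k p)

  V : Set
  V = CPVertex k p

  core-injective : ∀ {i j} → core {k} {p} i ≡ core j → i ≡ j
  core-injective refl = refl

  leaf-injective : ∀ {i} {l m : Fin (p i)} → leaf {k} {p} i l ≡ leaf i m → l ≡ m
  leaf-injective refl = refl

  _≟ᵥ_ : DecidableEquality V
  core i ≟ᵥ core j = map′ (cong core) core-injective (i Fin.≟ j)
  core _ ≟ᵥ leaf _ _ = no λ ()
  leaf _ _ ≟ᵥ core _ = no λ ()
  leaf i l ≟ᵥ leaf j m with i Fin.≟ j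
  ... | no i≢j = no λ { refl → i≢j refl }
  ... | yes refl = map′ (cong (leaf i)) leaf-injective (l Fin.≟ m)

  core-within-core : ∀ i j → Within 1 (core i) (core j)
  core-within-core i j with i Fin.≟ j
  ... | yes refl = within-refl
  ... | no i≢j = within-step (core-core i≢j) within-refl

  core-within : ∀ i y → Within 2 (core i) y
  core-within i (core j) = within-weaken (n≤1+n _) (core-within-core i j)
  core-within i (leaf j m) with i Fin.≟ j
  ... | yes refl = within-step (core-leaf i m) within-refl
  ... | no i≢j = within-step (core-core i≢j) (within-step (core-leaf j m) within-refl)

  dist≤3 : ∀ {x y r} → Dist x y r → r ≤ 3
  dist≤3 {core i} {y} d = dist≤within d (within-weaken (n≤1+n _) (core-within i y))
  dist≤3 {leaf i l} {y} d = dist≤within d (within-step (leaf-core i l) (core-within i y))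

  core-dist≤2 : ∀ {i y r} → Dist (core i) y r → r ≤ 2
  core-dist≤2 {i} {y} d = dist≤within d (core-within i y)

  leaf-dist≤2-unless-foreign : ∀ {i l y r} → Dist (leaf i l) y r
    → r ≤ 2 ⊎ ∃₂ λ j m → j ≢ i × y ≡ leaf j m
  leaf-dist≤2-unless-foreign {i} {l} {core j} d =
    inj₁ (dist≤within d (within-step (leaf-core i l) (core-within-core i j)))
  leaf-dist≤2-unless-foreign {i} {l} {leaf j m} d with j Fin.≟ i
  ... | yes refl = inj₁ (dist≤within d (within-step (leaf-core i l) (within-step (core-leaf i m) within-refl)))
  ... | no j≢i = inj₂ (j , m , j≢i , refl)

  dist₁-from-leaf : ∀ {i l y} → Dist (leaf i l) y 1 → y ≡ core i
  dist₁-from-leaf (step (leaf-core _ _) here , _) = refl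

  dist₁-to-leaf : ∀ {x i l} → Dist x (leaf i l) 1 → x ≡ core i
  dist₁-to-leaf (step (core-leaf _ _) here , _) = refl

  two-leaves-avoiding : ∀ {h} → 3 ≤ p h → ∀ t
    → ∃₂ λ l₁ l₂ → l₁ ≢ l₂ × leaf h l₁ ≢ t × leaf h l₂ ≢ t
  two-leaves-avoiding {h} 3≤ph t =
    let (a , only-a) = at-most-leaf t
        (l₁ , l₂ , l₁≢l₂ , l₁≢a , l₂≢a) = two-distinct-avoiding 3≤ph a
    in l₁ , l₂ , l₁≢l₂ , only-a l₁ l₁≢a , only-a l₂ l₂≢a
    where
    -- when t is not a leaf of h, any index will do
    at-most-leaf : ∀ t → ∃ λ a → ∀ l → l ≢ a → leaf h l ≢ t
    at-most-leaf (core _) = fromℕ< 3≤ph , λ _ _ ()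
    at-most-leaf (leaf j a) with j Fin.≟ h
    ... | yes refl = a , λ _ l≢a → l≢a ∘ leaf-injective
    ... | no j≢h = fromℕ< 3≤ph , λ { _ _ refl → j≢h refl }

  record Hub (t : V) : Set where
    field
      hub : Fin k
      many-leaves : 3 ≤ p hub
      core≢t : core hub ≢ t
      foreign-leaf≢t : ∀ j m → j ≢ hub → leaf j m ≢ t

  module Admissibility {t : V} (H : Hub t) where
    open Hub H renaming (hub to h)

    LoneLeaf : Config → Fin (p h) → Set
    LoneLeaf c l = leaf h l ≢ t × c (leaf h l) ≡ 1

    record Admissible (c : Config) : Set where
      field
        off-target≤3 : ∀ v → v ≢ t → c v ≤ 3
        core≤2 : c (core h) ≤ 2
        leaf≤2 : ∀ l → leaf h l ≢ t → c (leaf h l) ≤ 2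
        lone⇒core≡1 : ∀ {l} → LoneLeaf c l → c (core h) ≡ 1
        lone-unique : ∀ {l₁ l₂} → LoneLeaf c l₁ → LoneLeaf c l₂ → l₁ ≡ l₂

    module Reflect {c c' : Config} {x y : V} (1≤cx : 1 ≤ c x) (1≤cy : 1 ≤ c y)
                   (d : Dist x y (c x)) (c'x≡0 : c' x ≡ 0) (c'y≡ : c' y ≡ c y + c x)
                   (unchanged : ∀ v → v ≢ x → v ≢ y → c' v ≡ c v) (A : Admissible c') where
      open Admissible A

      cx<c'y : c x < c' y
      cx<c'y = subst (c x <_) (sym c'y≡) (m<n+m (c x) 1≤cy)

      cy<c'y : c y < c' y
      cy<c'y = subst (c y <_) (sym c'y≡) (m<m+n (c y) 1≤cx)

      source≤ : ∀ {n} → c' y ≤ suc n → c x ≤ n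
      source≤ c'y≤ = ≤-pred (≤-trans cx<c'y c'y≤)

      target≤ : ∀ {n} → c' y ≤ suc n → c y ≤ n
      target≤ c'y≤ = ≤-pred (≤-trans cy<c'y c'y≤)

      c'x≢1 : c' x ≢ 1
      c'x≢1 e = 1+n≢0 (trans (sym e) c'x≡0)

      c'y≢1 : c' y ≢ 1
      c'y≢1 e = <⇒≱ cx<c'y (subst (_≤ c x) (sym e) 1≤cx)

      ≤-after : ∀ v → v ≢ x → c v ≤ c' v
      ≤-after v v≢x with v ≟ᵥ y
      ... | yes refl = <⇒≤ cy<c'y
      ... | no v≢y = ≤-reflexive (sym (unchanged v v≢x v≢y))

      bound-backward : ∀ {n} v → (v ≡ x → c x ≤ n) → c' v ≤ n → c v ≤ n
      bound-backward v source-bound c'v≤n with v ≟ᵥ x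
      ... | yes refl = source-bound refl
      ... | no v≢x = ≤-trans (≤-after v v≢x) c'v≤n

      single-backward : ∀ v → c' v ≡ 1 → c v ≡ 1
      single-backward v e with v ≟ᵥ x | v ≟ᵥ y
      ... | yes refl | _ = ⊥-elim (c'x≢1 e)
      ... | no _ | yes refl = ⊥-elim (c'y≢1 e)
      ... | no v≢x | no v≢y = trans (sym (unchanged v v≢x v≢y)) e

      leaf-source≤2 : ∀ {l} → leaf h l ≡ x → c x ≤ 2
      leaf-source≤2 refl with leaf-dist≤2-unless-foreign d
      ... | inj₁ cx≤2 = cx≤2
      ... | inj₂ (j , m , j≢h , refl) = source≤ (off-target≤3 (leaf j m) (foreign-leaf≢t j m j≢h))

      Touched : V → Set
      Touched v = v ≡ x ⊎ v ≡ y

      touched? : ∀ v → Touched v ⊎ (v ≢ x × v ≢ y)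
      touched? v with v ≟ᵥ x | v ≟ᵥ y
      ... | yes v≡x | _ = inj₁ (inj₁ v≡x)
      ... | no _ | yes v≡y = inj₁ (inj₂ v≡y)
      ... | no v≢x | no v≢y = inj₂ (v≢x , v≢y)

      LeafCoreMove : Fin (p h) → Set
      LeafCoreMove l = (x ≡ leaf h l × y ≡ core h) ⊎ (x ≡ core h × y ≡ leaf h l)

      touched-lone⇒leaf-core-move : ∀ {l} → LoneLeaf c l → Touched (leaf h l) → LeafCoreMove l
      touched-lone⇒leaf-core-move (_ , cx≡1) (inj₁ refl) =
        inj₁ (refl , dist₁-from-leaf (subst (Dist x y) cx≡1 d))
      touched-lone⇒leaf-core-move {l} (l≢t , _) (inj₂ refl) =
        inj₂ (dist₁-to-leaf (subst (Dist x y) cx≡1 d) , refl)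
        where
        cx≡1 : c x ≡ 1
        cx≡1 = ≤-antisym (source≤ (leaf≤2 l l≢t)) 1≤cx

      leaf-core-move⇒core≡1 : ∀ {l} → LoneLeaf c l → LeafCoreMove l → c (core h) ≡ 1
      leaf-core-move⇒core≡1 _ (inj₁ (refl , refl)) = ≤-antisym (target≤ core≤2) 1≤cy
      leaf-core-move⇒core≡1 {l} (l≢t , _) (inj₂ (refl , refl)) =
        ≤-antisym (source≤ (leaf≤2 l l≢t)) 1≤cx

      leaf-core-move⇒c'core≢1 : ∀ {l} → LeafCoreMove l → c' (core h) ≢ 1
      leaf-core-move⇒c'core≢1 (inj₁ (_ , refl)) = c'y≢1
      leaf-core-move⇒c'core≢1 (inj₂ (refl , _)) = c'x≢1

      leaf-core-move⇒sibling-untouched : ∀ {l l'} → LeafCoreMove l → l' ≢ l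
        → leaf h l' ≢ x × leaf h l' ≢ y
      leaf-core-move⇒sibling-untouched (inj₁ (refl , refl)) l'≢l = l'≢l ∘ leaf-injective , λ ()
      leaf-core-move⇒sibling-untouched (inj₂ (refl , refl)) l'≢l = (λ ()) , l'≢l ∘ leaf-injective

      lone-untouched : ∀ {l} → LoneLeaf c l → leaf h l ≢ x × leaf h l ≢ y → LoneLeaf c' l
      lone-untouched (l≢t , cl≡1) (l≢x , l≢y) = l≢t , trans (unchanged _ l≢x l≢y) cl≡1

      lone⇒core≡1-backward : ∀ {l} → LoneLeaf c l → c (core h) ≡ 1
      lone⇒core≡1-backward {l} lone with touched? (leaf h l)
      ... | inj₁ touched = leaf-core-move⇒core≡1 lone (touched-lone⇒leaf-core-move lone touched)
      ... | inj₂ untouched = single-backward (core h) (lone⇒core≡1 (lone-untouched lone untouched))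

      touched-lone-excludes-sibling : ∀ {l l'} → LoneLeaf c l → Touched (leaf h l)
        → LoneLeaf c l' → l' ≢ l → ⊥
      touched-lone-excludes-sibling {l} lone touched lone' l'≢l =
        leaf-core-move⇒c'core≢1 exchange
          (lone⇒core≡1 (lone-untouched lone' (leaf-core-move⇒sibling-untouched exchange l'≢l)))
        where
        exchange : LeafCoreMove l
        exchange = touched-lone⇒leaf-core-move lone touched

      lone-unique-backward : ∀ {l₁ l₂} → LoneLeaf c l₁ → LoneLeaf c l₂ → l₁ ≡ l₂
      lone-unique-backward {l₁} {l₂} lone₁ lone₂
        with l₁ Fin.≟ l₂ | touched? (leaf h l₁) | touched? (leaf h l₂)
      ... | yes l₁≡l₂ | _ | _ = l₁≡l₂
      ... | no l₁≢l₂ | inj₁ touched₁ | _ =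
        ⊥-elim (touched-lone-excludes-sibling lone₁ touched₁ lone₂ (l₁≢l₂ ∘ sym))
      ... | no l₁≢l₂ | inj₂ _ | inj₁ touched₂ =
        ⊥-elim (touched-lone-excludes-sibling lone₂ touched₂ lone₁ l₁≢l₂)
      ... | no _ | inj₂ untouched₁ | inj₂ untouched₂ =
        lone-unique (lone-untouched lone₁ untouched₁) (lone-untouched lone₂ untouched₂)

      admissible : Admissible c
      admissible = record
        { off-target≤3 = λ v v≢t → bound-backward v (λ _ → dist≤3 d) (off-target≤3 v v≢t)
        ; core≤2 = bound-backward (core h) (λ { refl → core-dist≤2 d }) core≤2
        ; leaf≤2 = λ l l≢t → bound-backward (leaf h l) leaf-source≤2 (leaf≤2 l l≢t)
        ; lone⇒core≡1 = lone⇒core≡1-backward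
        ; lone-unique = lone-unique-backward
        }

    admissible-backward : ∀ {c c'} → Move c c' → Admissible c' → Admissible c
    admissible-backward (move _ _ _ 1≤cx 1≤cy d c'x≡0 c'y≡ unchanged) =
      Reflect.admissible 1≤cx 1≤cy d c'x≡0 c'y≡ unchanged

    admissible-stacked : ∀ f → (∀ v → v ≢ t → f v ≡ 0) → Admissible f
    admissible-stacked f stacked = record
      { off-target≤3 = λ v v≢t → empty≤ (stacked v v≢t)
      ; core≤2 = empty≤ (stacked (core h) core≢t)
      ; leaf≤2 = λ l l≢t → empty≤ (stacked (leaf h l) l≢t)
      ; lone⇒core≡1 = ⊥-elim ∘ no-lone
      ; lone-unique = λ lone _ → ⊥-elim (no-lone lone)
      }
      where
      empty≤ : ∀ {m n} → m ≡ 0 → m ≤ n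
      empty≤ refl = z≤n
      no-lone : ∀ {l} → ¬ LoneLeaf f l
      no-lone (l≢t , fl≡1) = 1+n≢0 (trans (sym fl≡1) (stacked _ l≢t))

    ¬admissible-initial : ¬ Admissible initial
    ¬admissible-initial A =
      let (l₁ , l₂ , l₁≢l₂ , l₁≢t , l₂≢t) = two-leaves-avoiding many-leaves t
      in l₁≢l₂ (Admissible.lone-unique A (l₁≢t , refl) (l₂≢t , refl))

  ¬stackable-with-hub : ∀ {t} → Hub t → ¬ Stackable t
  ¬stackable-with-hub {t} H =
    ¬stackable-by-backward-invariant t Admissible admissible-stacked admissible-backward ¬admissible-initial
    where open Admissibility H

  hub-exists : (∀ i → p i ≡ 0 ⊎ 3 ≤ p i) → (∃₂ λ i j → i ≢ j × 3 ≤ p i × 3 ≤ p j) → ∀ t → Hub t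
  hub-exists no-or-many _ (leaf g m) = record
    { hub = g
    ; many-leaves = many
    ; core≢t = λ ()
    ; foreign-leaf≢t = λ { _ _ j≢g refl → j≢g refl }
    }
    where
    many : 3 ≤ p g
    many with no-or-many g
    ... | inj₁ pg≡0 = ⊥-elim (¬Fin0 (subst Fin pg≡0 m))
    ... | inj₂ 3≤pg = 3≤pg
  hub-exists _ (i , j , i≢j , 3≤pi , 3≤pj) (core g) with i Fin.≟ g
  ... | no i≢g = record
    { hub = i ; many-leaves = 3≤pi ; core≢t = i≢g ∘ core-injective ; foreign-leaf≢t = λ _ _ _ () }
  ... | yes refl = record
    { hub = j ; many-leaves = 3≤pj ; core≢t = i≢j ∘ sym ∘ core-injective ; foreign-leaf≢t = λ _ _ _ () }

-- The hypothesis 2 ≤ k is implied by the two distinct hubs.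
theorem4p6 : (k : ℕ) → 2 ≤ k → (p : Fin k → ℕ)
    → (∀ i → p i ≡ 0 ⊎ 3 ≤ p i)
    → (∃₂ λ i j → i ≢ j × 3 ≤ p i × 3 ≤ p j)
    → CupStacking.StronglyNonStackable (CPAdj k p)
theorem4p6 k _ p no-or-many hubs t = ¬stackable-with-hub (hub-exists no-or-many hubs t)
  where open CliquePendant k p
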